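{- Let $2\le k\le n-2$ and $s_0\in\mathcal K_D(k,n)$. Let $J\in\binom{[n]}{k}$ be nonfrozen and let $a,b,c,d\in[n]$ be distinct, in this cyclic order in $(1,\ldots,n)$, with $a,c\notin J$, $b,d\in J$ (so that $e_J$, $e_J+e_a-e_b+e_c-e_d$, $e_J+e_a-e_b$, $e_J+e_c-e_d\in\Delta_{k,n}$). Then $$\eta_J(s_0)+\eta_{(J\setminus\{b,d\})\cup\{a,c\}}(s_0)-\eta_{(J\setminus\{b\})\cup\{a\}}(s_0)-\eta_{(J\setminus\{d\})\cup\{c\}}(s_0)\ge0,$$ and the inequality is strict (for all such $(a,b,c,d)$) if $s_0$ is interior, i.e. $(s_0)_I<0$ for every nonfrozen $I$.
   Context: $\mathbb R^{\binom nk}$ has coordinates $s_I$, $I\in\binom{[n]}k$. The kinematic space is $\mathcal K(k,n)=\{s:\sum_{I\ni j}s_I=0,\ j=1,\ldots,n\}$. A $k$-subset is frozen if it is a cyclic interval $\{j,\ldots,j+k-1\}$ mod $n$, else nonfrozen. $\mathcal K_D(k,n)=\{s\in\mathcal K(k,n): s_I\le0 \text{ for } I \text{ nonfrozen},\ s_I\ge0 \text{ for } I\text{ frozen}\}$. With $L_t(x)=x_{t+1}+2x_{t+2}+\cdots+(n-1)x_{t-1}$ (indices mod $n$) and $e_S=\sum_{s\in S}e_s$, define for any $K\in\binom{[n]}k$ the linear function $\eta_K(s)=-\frac1n\sum_{I\in\binom{[n]}k}\min\{L_1(e_I-e_K),\ldots,L_n(e_I-e_K)\}\,s_I$ on $\mathcal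 K(k,n)$. $\Delta_{k,n}=\{x\in[0,1]^n:\sum x_j=k\}$.
   Formalization: The point $s_0$ has rational coordinates $s_I$ instead of real ones. -}

module Defs where

open import Data.Nat as ℕ using (ℕ; zero; suc; _<ᵇ_; _≡ᵇ_)
open import Data.Nat.DivMod using (_%_)
open import Data.Integer as ℤ using (ℤ; +_; _⊓_)
open import Data.Rational as ℚ using (ℚ; 0ℚ; _/_)
open import Data.Fin as Fin using (Fin; toℕ)
open import Data.Fin.Subset using (Subset; ∣_∣; inside; outside)
open import Data.Vec using (Vec; []; _∷_; lookup; tabulate)
open import Data.List using (List; []; _∷_; map; _++_; filterᵇ; foldr; [_])
open import Data.Bool using (Bool; true; false; if_then_else_; _∧_)
open import Data.Product using (Σ; ∃; _×_)
open import Relation.Binary.PropositionalEquality using (_≡_)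
open import Relation.Nullary using (¬_)

-- Indices: [n] is represented by Fin n = {0,…,n-1} (shift by one of the paper's 1..n).
-- A subset of [n] is a characteristic vector (Subset n); k-subsets are those with ∣ I ∣ ≡ k.

allSubsets : (n : ℕ) → List (Subset n)
allSubsets zero = [ [] ]
allSubsets (suc n) = map (inside ∷_) (allSubsets n) ++ map (outside ∷_) (allSubsets n)

kSubsets : (k n : ℕ) → List (Subset n)
kSubsets k n = filterᵇ (λ I → ∣ I ∣ ≡ᵇ k) (allSubsets n)

sumℚ : List ℚ → ℚ
sumℚ = foldr ℚ._+_ 0ℚ

sumℤ : List ℤ → ℤ
sumℤ = foldr ℤ._+_ (+ 0)

sumFinℤ : ∀ {n} → (Fin n → ℤ) → ℤ
sumFinℤ {zero} f = + 0
sumFinℤ {suc n} f = f Fin.zero ℤ.+ sumFinℤ (λ i → f (Fin.suc i))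

-- minimum over Fin n (n ≥ 1; value 0 for n = 0, never used)
minFin : ∀ {n} → (Fin n → ℤ) → ℤ
minFin {zero} f = + 0
minFin {suc zero} f = f Fin.zero
minFin {suc (suc n)} f = f Fin.zero ⊓ minFin (λ i → f (Fin.suc i))

cycDist : ℕ → ℕ → ℕ → ℕ
cycDist zero i t = 0
cycDist (suc m) i t = (i ℕ.+ suc m ℕ.∸ t) % suc m

-- L_t(x) = x_{t+1} + 2 x_{t+2} + ⋯ + (n-1) x_{t-1}  (indices mod n)
-- = Σ_i ((i - t) mod n) · x_i
L : ∀ {n} → Fin n → (Fin n → ℤ) → ℤ
L {n} t x = sumFinℤ (λ i → + cycDist n (toℕ i) (toℕ t) ℤ.* x i)

e : ∀ {n} → Subset n → Fin n → ℤ
e S i with lookup S i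
... | true  = + 1
... | false = + 0

-- 1/n (n ≥ 1; value 0 for n = 0, never used)
invN : ℕ → ℚ
invN zero = 0ℚ
invN (suc m) = ℤ.+ 1 / suc m

η : (k n : ℕ) → Subset n → (Subset n → ℚ) → ℚ
η k n K s =
  ℚ.- (invN n ℚ.* sumℚ (map (λ I → (minFin (λ t → L t (λ i → e I i ℤ.- e K i)) / 1) ℚ.* s I)
                              (kSubsets k n)))

interval : (k n : ℕ) → Fin n → Subset n
interval k n j = tabulate (λ i → cycDist n (toℕ i) (toℕ j) <ᵇ k)

Frozen : (k n : ℕ) → Subset n → Set
Frozen k n I = ∃ λ j → I ≡ interval k n j

-- kinematic space K(k,n): Σ_{I ∋ j} s_I = 0 for all j (s only read on k-subsets)
Kinematic : (k n : ℕ) → (Subset n → ℚ) → Set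
Kinematic k n s = ∀ (j : Fin n) → sumℚ (map s (filterᵇ (λ I → lookup I j) (kSubsets k n))) ≡ 0ℚ

InKD : (k n : ℕ) → (Subset n → ℚ) → Set
InKD k n s = Kinematic k n s
  × (∀ I → ∣ I ∣ ≡ k → ¬ Frozen k n I → s I ℚ.≤ 0ℚ)
  × (∀ I → ∣ I ∣ ≡ k → Frozen k n I → 0ℚ ℚ.≤ s I)

Interior : (k n : ℕ) → (Subset n → ℚ) → Set
Interior k n s = ∀ I → ∣ I ∣ ≡ k → ¬ Frozen k n I → s I ℚ.< 0ℚ

CyclicOrder : ∀ {n} → Fin n → Fin n → Fin n → Fin n → Set
CyclicOrder a b c d =
  (a Fin.< b × b Fin.< c × c Fin.< d) Data.Sum.⊎
  ((b Fin.< c × c Fin.< d × d Fin.< a) Data.Sum.⊎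
  ((c Fin.< d × d Fin.< a × a Fin.< b) Data.Sum.⊎
   (d Fin.< a × a Fin.< b × b Fin.< c)))
  where import Data.Sum

{-# OPTIONS --safe #-}
module Submission where

-- Write Δ = (1/n) Σ_I W(I) · (-s_I), where the defect W(I) is
-- m_J(I) + m_{J[ac/bd]}(I) - m_{J[a/b]}(I) - m_{J[c/d]}(I) with m_K(I) = min_t L_t(e_I - e_K),
-- and J[x/y] trades y ∈ J for x ∉ J. For p_t = L_t(e_I - e_J), trading b for a subtracts
-- α_t = L_t(e_a - e_b), which up to a constant is n times the indicator of the cyclic arc (a, b];
-- likewise γ for (c, d]. These arcs are disjoint, and for perturbations with disjoint supports
-- min p + min (p - α - γ) ≥ min (p - α) + min (p - γ), so W(I) ≥ 0. If I = [j, j + k) is frozen,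
-- e_I - e_K is nonnegative on I and nonpositive off it, which makes t = j a common minimiser and
-- gives W(I) = 0. Hence every term is ≥ 0 on K_D, and W(J) = n makes the term of J positive when
-- s is interior.

open import Defs
open import Data.Bool using (Bool; true; false; not; _∧_; _∨_)
open import Data.Empty using (⊥; ⊥-elim)
open import Data.Fin using (Fin; zero; suc; toℕ)
import Data.Fin.Properties as Finₚ
open import Data.Fin.Subset using (Subset; ∣_∣; _∈_; _∉_; _∪_; _─_; ⁅_⁆)
import Data.Fin.Subset.Properties as Subsetₚ
open import Data.Nat using (ℕ; zero; suc; _<ᵇ_; _≡ᵇ_)
open import Data.Nat as ℕ using ()
import Data.Nat.Properties as ℕₚ
open import Data.Product using (_×_; ∃; _,_; proj₁; proj₂)
open import Data.Sum using (_⊎_; inj₁; inj₂)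
open import Data.Vec using ([]; _∷_; lookup)
import Data.Vec.Properties as Vecₚ
open import Function using (_∘_)
open import Relation.Binary.PropositionalEquality
  using (_≡_; _≢_; ≢-sym; refl; sym; trans; cong; cong₂; subst; subst₂; module ≡-Reasoning)
open import Relation.Nullary using (¬_; yes; no)

module SumsAndMinima where
  open import Data.Integer using (ℤ; +_; 0ℤ; _+_; _-_; _*_; _≤_; _⊓_)
  import Data.Integer.Properties as ℤₚ
  open import Data.Integer.Tactic.RingSolver using (solve-∀)

  sumFinℤ-cong : ∀ {n} {f g : Fin n → ℤ} → (∀ i → f i ≡ g i) → sumFinℤ f ≡ sumFinℤ g
  sumFinℤ-cong {zero}  f≗g = refl
  sumFinℤ-cong {suc n} f≗g = cong₂ _+_ (f≗g zero) (sumFinℤ-cong (f≗g ∘ suc))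

  sumFinℤ-+ : ∀ {n} (f g : Fin n → ℤ) → sumFinℤ (λ i → f i + g i) ≡ sumFinℤ f + sumFinℤ g
  sumFinℤ-+ {zero}  f g = refl
  sumFinℤ-+ {suc n} f g =
    trans (cong (_+_ (f zero + g zero)) (sumFinℤ-+ (f ∘ suc) (g ∘ suc))) (swap-middle (f zero) (g zero) (sumFinℤ (f ∘ suc)) (sumFinℤ (g ∘ suc)))
    where
    swap-middle : ∀ a b c d → (a + b) + (c + d) ≡ (a + c) + (b + d)
    swap-middle = solve-∀

  sumFinℤ-sub : ∀ {n} (f g : Fin n → ℤ) → sumFinℤ (λ i → f i - g i) ≡ sumFinℤ f - sumFinℤ g
  sumFinℤ-sub {zero}  f g = refl
  sumFinℤ-sub {suc n} f g =
    trans (cong (_+_ (f zero - g zero)) (sumFinℤ-sub (f ∘ suc) (g ∘ suc))) (regroup (f zero) (g zero) (sumFinℤ (f ∘ suc)) (sumFinℤ (g ∘ suc)))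
    where
    regroup : ∀ a b c d → (a - b) + (c - d) ≡ (a + c) - (b + d)
    regroup = solve-∀

  sumFinℤ-*ˡ : ∀ {n} c (f : Fin n → ℤ) → sumFinℤ (λ i → c * f i) ≡ c * sumFinℤ f
  sumFinℤ-*ˡ {zero}  c f = sym (ℤₚ.*-zeroʳ c)
  sumFinℤ-*ˡ {suc n} c f =
    trans (cong (_+_ (c * f zero)) (sumFinℤ-*ˡ c (f ∘ suc))) (sym (ℤₚ.*-distribˡ-+ c (f zero) _))

  sumFinℤ-mono-≤ : ∀ {n} {f g : Fin n → ℤ} → (∀ i → f i ≤ g i) → sumFinℤ f ≤ sumFinℤ g
  sumFinℤ-mono-≤ {zero}  f≤g = ℤₚ.≤-refl
  sumFinℤ-mono-≤ {suc n} f≤g = ℤₚ.+-mono-≤ (f≤g zero) (sumFinℤ-mono-≤ (f≤g ∘ suc))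

  sumFinℤ-zero : ∀ n → sumFinℤ {n} (λ _ → 0ℤ) ≡ 0ℤ
  sumFinℤ-zero zero    = refl
  sumFinℤ-zero (suc n) = trans (ℤₚ.+-identityˡ _) (sumFinℤ-zero n)

  sumFinℤ-nonneg : ∀ {n} {f : Fin n → ℤ} → (∀ i → 0ℤ ≤ f i) → 0ℤ ≤ sumFinℤ f
  sumFinℤ-nonneg {n} {f} 0≤f = subst (_≤ sumFinℤ f) (sumFinℤ-zero n) (sumFinℤ-mono-≤ 0≤f)

  sumFinℤ-nonpos : ∀ {n} {f : Fin n → ℤ} → (∀ i → f i ≤ 0ℤ) → sumFinℤ f ≤ 0ℤ
  sumFinℤ-nonpos {n} {f} f≤0 = subst (sumFinℤ f ≤_) (sumFinℤ-zero n) (sumFinℤ-mono-≤ f≤0)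

  minFin-≤ : ∀ {n} (f : Fin n → ℤ) t → minFin f ≤ f t
  minFin-≤ {suc zero}    f zero    = ℤₚ.≤-refl
  minFin-≤ {suc (suc n)} f zero    = ℤₚ.i⊓j≤i _ _
  minFin-≤ {suc (suc n)} f (suc t) = ℤₚ.≤-trans (ℤₚ.i⊓j≤j _ _) (minFin-≤ (f ∘ suc) t)

  minFin-glb : ∀ {n} (f : Fin (suc n) → ℤ) {b} → (∀ t → b ≤ f t) → b ≤ minFin f
  minFin-glb {zero}  f b≤f = b≤f zero
  minFin-glb {suc n} f b≤f = ℤₚ.⊓-glb (b≤f zero) (minFin-glb (f ∘ suc) (b≤f ∘ suc))

  minFin-attained : ∀ {n} (f : Fin (suc n) → ℤ) → ∃ λ t → minFin f ≡ f t
  minFin-attained {zero}  f = zero , refl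
  minFin-attained {suc n} f with ℤₚ.⊓-sel (f zero) (minFin (f ∘ suc))
  ... | inj₁ min≡f0 = zero , min≡f0
  ... | inj₂ min≡rest with minFin-attained (f ∘ suc)
  ...   | t , eq = suc t , trans min≡rest eq

  minFin-cong : ∀ {n} {f g : Fin n → ℤ} → (∀ t → f t ≡ g t) → minFin f ≡ minFin g
  minFin-cong {zero}        f≗g = refl
  minFin-cong {suc zero}    f≗g = f≗g zero
  minFin-cong {suc (suc n)} f≗g = cong₂ _⊓_ (f≗g zero) (minFin-cong (f≗g ∘ suc))

  minFin-+ : ∀ {n} (f : Fin (suc n) → ℤ) c → minFin (λ t → f t + c) ≡ minFin f + c
  minFin-+ {zero}  f c = refl
  minFin-+ {suc n} f c = begin
    (f zero + c) ⊓ minFin (λ t → f (suc t) + c) ≡⟨ cong ((f zero + c) ⊓_) (minFin-+ (f ∘ suc) c) ⟩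
    (f zero + c) ⊓ (minFin (f ∘ suc) + c)       ≡⟨ ℤₚ.mono-≤-distrib-⊓ (ℤₚ.+-monoˡ-≤ c) (f zero) (minFin (f ∘ suc)) ⟨
    (f zero ⊓ minFin (f ∘ suc)) + c             ∎
    where open ≡-Reasoning
open SumsAndMinima

module Indicators where
  open import Data.Integer as ℤ using (ℤ; +_; 0ℤ; 1ℤ; _+_; _-_; _*_; _≤_)
  import Data.Integer.Properties as ℤₚ
  open import Data.Integer.Tactic.RingSolver using (solve-∀)
  import Data.Bool.Properties as Boolₚ
  open import Data.Fin.Subset using () renaming (⊥ to ∅)

  𝟙 : Bool → ℤ
  𝟙 true  = 1ℤ
  𝟙 false = 0ℤ

  e≡𝟙∘lookup : ∀ {n} (S : Subset n) i → e S i ≡ 𝟙 (lookup S i)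
  e≡𝟙∘lookup S i with lookup S i
  ... | true  = refl
  ... | false = refl

  lookup-∉ : ∀ {n} {S : Subset n} {i} → i ∉ S → lookup S i ≡ false
  lookup-∉ {S = S} {i} i∉S with lookup S i in eq
  ... | true  = ⊥-elim (i∉S (Vecₚ.lookup⇒[]= i S eq))
  ... | false = refl

  lookup-─ : ∀ {n} (p q : Subset n) i → lookup (p ─ q) i ≡ lookup p i ∧ not (lookup q i)
  lookup-─ (x ∷ p) (true  ∷ q) zero    = sym (Boolₚ.∧-zeroʳ x)
  lookup-─ (x ∷ p) (false ∷ q) zero    = sym (Boolₚ.∧-identityʳ x)
  lookup-─ (x ∷ p) (y     ∷ q) (suc i) = lookup-─ p q i

  e-∪ : ∀ {n} (p q : Subset n) i → (i ∈ p → i ∉ q) → e (p ∪ q) i ≡ e p i + e q i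
  e-∪ p q i disjoint = begin
    e (p ∪ q) i                     ≡⟨ e≡𝟙∘lookup (p ∪ q) i ⟩
    𝟙 (lookup (p ∪ q) i)            ≡⟨ cong 𝟙 (Vecₚ.lookup-zipWith _∨_ i p q) ⟩
    𝟙 (lookup p i ∨ lookup q i)     ≡⟨ 𝟙-∨ (lookup p i) (lookup q i) (lookup-∉ ∘ disjoint ∘ Vecₚ.lookup⇒[]= i p) ⟩
    𝟙 (lookup p i) + 𝟙 (lookup q i) ≡⟨ cong₂ _+_ (e≡𝟙∘lookup p i) (e≡𝟙∘lookup q i) ⟨
    e p i + e q i                   ∎
    where
    open ≡-Reasoning
    𝟙-∨ : ∀ x y → (x ≡ true → y ≡ false) → 𝟙 (x ∨ y) ≡ 𝟙 x + 𝟙 y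
    𝟙-∨ true  true  excl with () ← excl refl
    𝟙-∨ true  false _    = refl
    𝟙-∨ false true  _    = refl
    𝟙-∨ false false _    = refl

  e-─ : ∀ {n} (p q : Subset n) i → (i ∈ q → i ∈ p) → e (p ─ q) i ≡ e p i - e q i
  e-─ p q i q⊆p = begin
    e (p ─ q) i                       ≡⟨ e≡𝟙∘lookup (p ─ q) i ⟩
    𝟙 (lookup (p ─ q) i)              ≡⟨ cong 𝟙 (lookup-─ p q i) ⟩
    𝟙 (lookup p i ∧ not (lookup q i)) ≡⟨ 𝟙-∧-not (lookup p i) (lookup q i) (Vecₚ.[]=⇒lookup ∘ q⊆p ∘ Vecₚ.lookup⇒[]= i q) ⟩
    𝟙 (lookup p i) - 𝟙 (lookup q i)   ≡⟨ cong₂ _-_ (e≡𝟙∘lookup p i) (e≡𝟙∘lookup q i) ⟨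
    e p i - e q i                     ∎
    where
    open ≡-Reasoning
    𝟙-∧-not : ∀ x y → (y ≡ true → x ≡ true) → 𝟙 (x ∧ not y) ≡ 𝟙 x - 𝟙 y
    𝟙-∧-not true  true  _    = refl
    𝟙-∧-not true  false _    = refl
    𝟙-∧-not false true  incl with () ← incl refl
    𝟙-∧-not false false _    = refl

  0≤e : ∀ {n} (S : Subset n) i → 0ℤ ≤ e S i
  0≤e S i with lookup S i
  ... | true  = ℤ.+≤+ ℕ.z≤n
  ... | false = ℤ.+≤+ ℕ.z≤n

  e≤1 : ∀ {n} (S : Subset n) i → e S i ≤ 1ℤ
  e≤1 S i with lookup S i
  ... | true  = ℤ.+≤+ (ℕ.s≤s ℕ.z≤n)
  ... | false = ℤ.+≤+ ℕ.z≤n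

  sumFinℤ-e : ∀ {n} (S : Subset n) → sumFinℤ (e S) ≡ + ∣ S ∣
  sumFinℤ-e []          = refl
  sumFinℤ-e (true  ∷ S) = trans (cong (_+_ 1ℤ) (sumFinℤ-e S)) (sym (ℤₚ.pos-+ 1 ∣ S ∣))
  sumFinℤ-e (false ∷ S) = trans (ℤₚ.+-identityˡ _) (sumFinℤ-e S)

  sumFinℤ-*-e⁅⁆ : ∀ {n} (f : Fin n → ℤ) a → sumFinℤ (λ i → f i * e ⁅ a ⁆ i) ≡ f a
  sumFinℤ-*-e⁅⁆ {suc n} f zero = begin
    f zero * 1ℤ + sumFinℤ (λ i → f (suc i) * e ∅ i) ≡⟨ cong₂ _+_ (ℤₚ.*-identityʳ (f zero)) (sumFinℤ-cong vanish) ⟩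
    f zero + sumFinℤ {n} (λ _ → 0ℤ)                 ≡⟨ cong (_+_ (f zero)) (sumFinℤ-zero n) ⟩
    f zero + 0ℤ                                      ≡⟨ ℤₚ.+-identityʳ (f zero) ⟩
    f zero                                           ∎
    where
    open ≡-Reasoning
    vanish : ∀ i → f (suc i) * e ∅ i ≡ 0ℤ
    vanish i = begin
      f (suc i) * e ∅ i           ≡⟨ cong (f (suc i) *_) (e≡𝟙∘lookup ∅ i) ⟩
      f (suc i) * 𝟙 (lookup ∅ i)  ≡⟨ cong (λ x → f (suc i) * 𝟙 x) (Vecₚ.lookup-replicate i false) ⟩
      f (suc i) * 0ℤ              ≡⟨ ℤₚ.*-zeroʳ (f (suc i)) ⟩
      0ℤ                          ∎
  sumFinℤ-*-e⁅⁆ {suc n} f (suc a) =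
    trans (cong (_+ sumFinℤ (λ i → f (suc i) * e ⁅ a ⁆ i)) (ℤₚ.*-zeroʳ (f zero)))
          (trans (ℤₚ.+-identityˡ (sumFinℤ (λ i → f (suc i) * e ⁅ a ⁆ i))) (sumFinℤ-*-e⁅⁆ (f ∘ suc) a))

  -- A record rather than a function type, so that S, y, x and K are inferable from a proof.
  record Swap {n} (S : Subset n) (y x : Fin n) (K : Subset n) : Set where
    field e-swap : ∀ i → e K i ≡ (e S i - e ⁅ y ⁆ i) + e ⁅ x ⁆ i
  open Swap public

  swap-─∪ : ∀ {n} {S : Subset n} {x y} → x ∉ S → y ∈ S → Swap S y x ((S ─ ⁅ y ⁆) ∪ ⁅ x ⁆)
  e-swap (swap-─∪ {S = S} {x} {y} x∉S y∈S) i =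
    trans (e-∪ (S ─ ⁅ y ⁆) ⁅ x ⁆ i (λ i∈S-y i∈x → x∉S (subst (_∈ S) (Subsetₚ.x∈⁅y⁆⇒x≡y x i∈x) (Subsetₚ.p─q⊆p S ⁅ y ⁆ i∈S-y))))
          (cong (_+ e ⁅ x ⁆ i) (e-─ S ⁅ y ⁆ i (λ i∈y → subst (_∈ S) (sym (Subsetₚ.x∈⁅y⁆⇒x≡y y i∈y)) y∈S)))

  sumFinℤ-e⁅⁆ : ∀ {n} (x : Fin n) → sumFinℤ (e ⁅ x ⁆) ≡ 1ℤ
  sumFinℤ-e⁅⁆ x = trans (sumFinℤ-e ⁅ x ⁆) (cong +_ (Subsetₚ.∣⁅x⁆∣≡1 x))

  sumFinℤ-swap : ∀ {n} {S K : Subset n} {x y} → Swap S y x K → sumFinℤ (e K) ≡ sumFinℤ (e S)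
  sumFinℤ-swap {S = S} {K} {x} {y} K≐S = begin
    sumFinℤ (e K)                                               ≡⟨ sumFinℤ-cong (e-swap K≐S) ⟩
    sumFinℤ (λ i → (e S i - e ⁅ y ⁆ i) + e ⁅ x ⁆ i)             ≡⟨ sumFinℤ-+ (λ i → e S i - e ⁅ y ⁆ i) (e ⁅ x ⁆) ⟩
    sumFinℤ (λ i → e S i - e ⁅ y ⁆ i) + sumFinℤ (e ⁅ x ⁆)       ≡⟨ cong₂ _+_ (sumFinℤ-sub (e S) (e ⁅ y ⁆)) (sumFinℤ-e⁅⁆ x) ⟩
    (sumFinℤ (e S) - sumFinℤ (e ⁅ y ⁆)) + 1ℤ                    ≡⟨ cong (λ σ → (sumFinℤ (e S) - σ) + 1ℤ) (sumFinℤ-e⁅⁆ y) ⟩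
    (sumFinℤ (e S) - 1ℤ) + 1ℤ                                   ≡⟨ cancel (sumFinℤ (e S)) ⟩
    sumFinℤ (e S)                                               ∎
    where
    open ≡-Reasoning
    cancel : ∀ σ → (σ - 1ℤ) + 1ℤ ≡ σ
    cancel = solve-∀
open Indicators

module CyclicDistance where
  open import Data.Integer using (ℤ; +_; 0ℤ; 1ℤ; _+_; _-_; _*_)
  import Data.Integer.Properties as ℤₚ
  open import Data.Integer.Tactic.RingSolver using (solve-∀)
  open import Data.Nat using (_<_; _≤_; _∸_) renaming (_+_ to _+ℕ_)
  open import Data.Nat.DivMod using (_%_; m<n⇒m%n≡m; [m+n]%n≡m%n)
  open import Relation.Nullary.Reflects using (ofʸ; ofⁿ)

  pos-∸ : ∀ {a b} → b ≤ a → + (a ∸ b) ≡ + a - + b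
  pos-∸ {a} {b} b≤a = trans (sym (ℤₚ.⊖-≥ b≤a)) (sym (ℤₚ.m-n≡m⊖n a b))

  dist : ∀ {n} → Fin n → Fin n → ℕ
  dist {n} i t = cycDist n (toℕ i) (toℕ t)

  -- arc a b t is 1 if t lies on the cyclic arc (a, b], and 0 otherwise
  arc : ℕ → ℕ → ℕ → ℤ
  arc a b t = (𝟙 (a <ᵇ t) - 𝟙 (b <ᵇ t)) + 𝟙 (b <ᵇ a)

  arc-0∨1 : ∀ a b t → arc a b t ≡ 0ℤ ⊎ arc a b t ≡ 1ℤ
  arc-0∨1 a b t
    with a <ᵇ t | ℕₚ.<ᵇ-reflects-< a t | b <ᵇ t | ℕₚ.<ᵇ-reflects-< b t | b <ᵇ a | ℕₚ.<ᵇ-reflects-< b a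
  ... | true  | _       | true  | _       | true  | _       = inj₂ refl
  ... | true  | _       | true  | _       | false | _       = inj₁ refl
  ... | true  | ofʸ a<t | false | ofⁿ b≮t | true  | ofʸ b<a = ⊥-elim (b≮t (ℕₚ.<-trans b<a a<t))
  ... | true  | _       | false | _       | false | _       = inj₂ refl
  ... | false | _       | true  | _       | true  | _       = inj₁ refl
  ... | false | ofⁿ a≮t | true  | ofʸ b<t | false | ofⁿ b≮a = ⊥-elim (b≮a (ℕₚ.<-≤-trans b<t (ℕₚ.≮⇒≥ a≮t)))
  ... | false | _       | false | _       | true  | _       = inj₂ refl
  ... | false | _       | false | _       | false | _       = inj₁ refl

  arc-end : ∀ {a b} → a ≢ b → arc a b b ≡ 1ℤ
  arc-end {a} {b} a≢b
    with a <ᵇ b | ℕₚ.<ᵇ-reflects-< a b | b <ᵇ b | ℕₚ.<ᵇ-reflects-< b b | b <ᵇ a | ℕₚ.<ᵇ-reflects-< b a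
  ... | _     | _       | true  | ofʸ b<b | _     | _       = ⊥-elim (ℕₚ.<-irrefl refl b<b)
  ... | true  | ofʸ a<b | false | _       | true  | ofʸ b<a = ⊥-elim (ℕₚ.<-asym a<b b<a)
  ... | true  | _       | false | _       | false | _       = refl
  ... | false | _       | false | _       | true  | _       = refl
  ... | false | ofⁿ a≮b | false | _       | false | ofⁿ b≮a = ⊥-elim (a≢b (ℕₚ.≤-antisym (ℕₚ.≮⇒≥ b≮a) (ℕₚ.≮⇒≥ a≮b)))

  arc≡1⇒between : ∀ {a b t} → a < b → arc a b t ≡ 1ℤ → a < t × t ≤ b
  arc≡1⇒between {a} {b} {t} a<b on-arc
    with a <ᵇ t | ℕₚ.<ᵇ-reflects-< a t | b <ᵇ t | ℕₚ.<ᵇ-reflects-< b t | b <ᵇ a | ℕₚ.<ᵇ-reflects-< b a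
  ... | _     | _       | _     | _       | true  | ofʸ b<a = ⊥-elim (ℕₚ.<-asym a<b b<a)
  ... | true  | ofʸ a<t | false | ofⁿ b≮t | false | _       = a<t , ℕₚ.≮⇒≥ b≮t
  ... | true  | _       | true  | _       | false | _       with () ← on-arc
  ... | false | _       | true  | _       | false | _       with () ← on-arc
  ... | false | _       | false | _       | false | _       with () ← on-arc

  arc≡1⇒outside : ∀ {a b t} → b < a → arc a b t ≡ 1ℤ → t ≤ b ⊎ a < t
  arc≡1⇒outside {a} {b} {t} b<a on-arc
    with a <ᵇ t | ℕₚ.<ᵇ-reflects-< a t | b <ᵇ t | ℕₚ.<ᵇ-reflects-< b t | b <ᵇ a | ℕₚ.<ᵇ-reflects-< b a
  ... | _     | _       | _     | _       | false | ofⁿ b≮a = ⊥-elim (b≮a b<a)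
  ... | true  | ofʸ a<t | _     | _       | true  | _       = inj₂ a<t
  ... | false | _       | false | ofⁿ b≮t | true  | _       = inj₁ (ℕₚ.≮⇒≥ b≮t)
  ... | false | _       | true  | _       | true  | _       with () ← on-arc

  arcs-disjoint : ∀ {n} {a b c d : Fin n} → CyclicOrder a b c d → (t : Fin n) →
                  arc (toℕ a) (toℕ b) (toℕ t) ≡ 1ℤ → arc (toℕ c) (toℕ d) (toℕ t) ≡ 1ℤ → ⊥
  arcs-disjoint (inj₁ (a<b , b<c , c<d)) t t∈ab t∈cd
    with arc≡1⇒between {t = toℕ t} a<b t∈ab | arc≡1⇒between {t = toℕ t} c<d t∈cd
  ... | _ , t≤b | c<t , _ = ℕₚ.<-asym c<t (ℕₚ.≤-<-trans t≤b b<c)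
  arcs-disjoint (inj₂ (inj₁ (b<c , c<d , d<a))) t t∈ab t∈cd
    with arc≡1⇒outside {t = toℕ t} (ℕₚ.<-trans b<c (ℕₚ.<-trans c<d d<a)) t∈ab | arc≡1⇒between {t = toℕ t} c<d t∈cd
  ... | inj₁ t≤b | c<t , _ = ℕₚ.<-asym c<t (ℕₚ.≤-<-trans t≤b b<c)
  ... | inj₂ a<t | _ , t≤d = ℕₚ.<-asym a<t (ℕₚ.≤-<-trans t≤d d<a)
  arcs-disjoint (inj₂ (inj₂ (inj₁ (c<d , d<a , a<b)))) t t∈ab t∈cd
    with arc≡1⇒between {t = toℕ t} a<b t∈ab | arc≡1⇒between {t = toℕ t} c<d t∈cd
  ... | a<t , _ | _ , t≤d = ℕₚ.<-asym a<t (ℕₚ.≤-<-trans t≤d d<a)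
  arcs-disjoint (inj₂ (inj₂ (inj₂ (d<a , a<b , b<c)))) t t∈ab t∈cd
    with arc≡1⇒between {t = toℕ t} a<b t∈ab | arc≡1⇒outside {t = toℕ t} (ℕₚ.<-trans d<a (ℕₚ.<-trans a<b b<c)) t∈cd
  ... | a<t , _ | inj₁ t≤d = ℕₚ.<-asym a<t (ℕₚ.≤-<-trans t≤d d<a)
  ... | _ , t≤b | inj₂ c<t = ℕₚ.<-asym c<t (ℕₚ.≤-<-trans t≤b b<c)

  cyclic-distinct : ∀ {n} {a b c d : Fin n} → CyclicOrder a b c d → a ≢ c × b ≢ d
  cyclic-distinct (inj₁ (a<b , b<c , c<d)) =
    Finₚ.<⇒≢ (ℕₚ.<-trans a<b b<c) , Finₚ.<⇒≢ (ℕₚ.<-trans b<c c<d)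
  cyclic-distinct (inj₂ (inj₁ (b<c , c<d , d<a))) =
    ≢-sym (Finₚ.<⇒≢ (ℕₚ.<-trans c<d d<a)) , Finₚ.<⇒≢ (ℕₚ.<-trans b<c c<d)
  cyclic-distinct (inj₂ (inj₂ (inj₁ (c<d , d<a , a<b)))) =
    ≢-sym (Finₚ.<⇒≢ (ℕₚ.<-trans c<d d<a)) , ≢-sym (Finₚ.<⇒≢ (ℕₚ.<-trans d<a a<b))
  cyclic-distinct (inj₂ (inj₂ (inj₂ (d<a , a<b , b<c)))) =
    Finₚ.<⇒≢ (ℕₚ.<-trans a<b b<c) , ≢-sym (Finₚ.<⇒≢ (ℕₚ.<-trans d<a a<b))

  module _ {m : ℕ} where
    private
      N : ℕ
      N = suc m

    dist-≥ : {i j : Fin N} → toℕ j ≤ toℕ i → dist i j ≡ toℕ i ∸ toℕ j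
    dist-≥ {i} {j} j≤i = begin
      (toℕ i +ℕ N ∸ toℕ j) % N   ≡⟨ cong (_% N) (ℕₚ.+-∸-comm N j≤i) ⟩
      (toℕ i ∸ toℕ j +ℕ N) % N   ≡⟨ [m+n]%n≡m%n (toℕ i ∸ toℕ j) N ⟩
      (toℕ i ∸ toℕ j) % N        ≡⟨ m<n⇒m%n≡m (ℕₚ.≤-<-trans (ℕₚ.m∸n≤m (toℕ i) (toℕ j)) (Finₚ.toℕ<n i)) ⟩
      toℕ i ∸ toℕ j              ∎
      where open ≡-Reasoning

    dist-< : {i j : Fin N} → toℕ i < toℕ j → dist i j ≡ toℕ i +ℕ N ∸ toℕ j
    dist-< {i} {j} i<j = m<n⇒m%n≡m (ℕₚ.m<n+o⇒m∸n<o (toℕ i +ℕ N) (toℕ j) (ℕₚ.+-monoˡ-< N i<j))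

    dist-ℤ : (i t : Fin N) → + dist i t ≡ (+ toℕ i - + toℕ t) + + N * 𝟙 (toℕ i <ᵇ toℕ t)
    dist-ℤ i t with toℕ i <ᵇ toℕ t | ℕₚ.<ᵇ-reflects-< (toℕ i) (toℕ t)
    ... | true  | ofʸ i<t = begin
      + dist i t                        ≡⟨ cong +_ (dist-< i<t) ⟩
      + (toℕ i +ℕ N ∸ toℕ t)            ≡⟨ pos-∸ (ℕₚ.≤-trans (ℕₚ.<⇒≤ (Finₚ.toℕ<n t)) (ℕₚ.m≤n+m N (toℕ i))) ⟩
      + (toℕ i +ℕ N) - + toℕ t          ≡⟨ cong (_- + toℕ t) (ℤₚ.pos-+ (toℕ i) N) ⟩
      (+ toℕ i + + N) - + toℕ t         ≡⟨ shift (+ toℕ i) (+ toℕ t) (+ N) ⟩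
      (+ toℕ i - + toℕ t) + + N * 1ℤ    ∎
      where
      open ≡-Reasoning
      shift : ∀ x y z → (x + z) - y ≡ (x - y) + z * 1ℤ
      shift = solve-∀
    ... | false | ofⁿ i≮t = begin
      + dist i t                        ≡⟨ cong +_ (dist-≥ (ℕₚ.≮⇒≥ i≮t)) ⟩
      + (toℕ i ∸ toℕ t)                 ≡⟨ pos-∸ (ℕₚ.≮⇒≥ i≮t) ⟩
      + toℕ i - + toℕ t                 ≡⟨ no-shift (+ toℕ i - + toℕ t) (+ N) ⟩
      (+ toℕ i - + toℕ t) + + N * 0ℤ    ∎
      where
      open ≡-Reasoning
      no-shift : ∀ x z → x ≡ x + z * 0ℤ
      no-shift = solve-∀

    dist-difference : (a b : Fin N) →
      ∃ λ c → ∀ t → + dist a t - + dist b t ≡ c + + N * arc (toℕ a) (toℕ b) (toℕ t)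
    dist-difference a b = (+ toℕ a - + toℕ b) - + N * 𝟙 (toℕ b <ᵇ toℕ a) , λ t → trans (cong₂ _-_ (dist-ℤ a t) (dist-ℤ b t))
      (regroup (+ toℕ a) (+ toℕ b) (+ toℕ t) (+ N) (𝟙 (toℕ a <ᵇ toℕ t)) (𝟙 (toℕ b <ᵇ toℕ t)) (𝟙 (toℕ b <ᵇ toℕ a)))
      where
      regroup : ∀ a b t N x y z → ((a - t) + N * x) - ((b - t) + N * y) ≡ ((a - b) - N * z) + N * ((x - y) + z)
      regroup = solve-∀
open CyclicDistance

module LinearForms where
  open import Data.Integer using (ℤ; +_; 0ℤ; _+_; _-_; _*_)
  import Data.Integer.Properties as ℤₚ
  open import Data.Integer.Tactic.RingSolver using (solve-∀)

  L-cong : ∀ {n} (t : Fin n) {x y : Fin n → ℤ} → (∀ i → x i ≡ y i) → L t x ≡ L t y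
  L-cong t x≗y = sumFinℤ-cong (λ i → cong (+ dist i t *_) (x≗y i))

  L-sub : ∀ {n} (t : Fin n) (x y : Fin n → ℤ) → L t (λ i → x i - y i) ≡ L t x - L t y
  L-sub t x y = trans (sumFinℤ-cong (λ i → distrib (+ dist i t) (x i) (y i)))
                    (sumFinℤ-sub (λ i → + dist i t * x i) (λ i → + dist i t * y i))
    where
    distrib : ∀ c u v → c * (u - v) ≡ c * u - c * v
    distrib = solve-∀

  L-e⁅⁆ : ∀ {n} (t a : Fin n) → L t (e ⁅ a ⁆) ≡ + dist a t
  L-e⁅⁆ t a = sumFinℤ-*-e⁅⁆ (λ i → + dist i t) a

  L-zero : ∀ {n} (t : Fin n) {x : Fin n → ℤ} → (∀ i → x i ≡ 0ℤ) → L t x ≡ 0ℤ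
  L-zero {n} t x≗0 =
    trans (sumFinℤ-cong (λ i → trans (cong (+ dist i t *_) (x≗0 i)) (ℤₚ.*-zeroʳ (+ dist i t))))
          (sumFinℤ-zero n)

  L-swap : ∀ {n} {S K : Subset n} {x y} → Swap S y x K → (I : Subset n) (t : Fin n) →
           L t (λ i → e I i - e K i) ≡ L t (λ i → e I i - e S i) - (+ dist x t - + dist y t)
  L-swap {S = S} {K} {x} {y} K≐S I t = begin
    L t (λ i → e I i - e K i)
      ≡⟨ L-cong t (λ i → trans (cong (_-_ (e I i)) (e-swap K≐S i)) (regroup (e I i) (e S i) (e ⁅ y ⁆ i) (e ⁅ x ⁆ i))) ⟩
    L t (λ i → (e I i - e S i) - (e ⁅ x ⁆ i - e ⁅ y ⁆ i))
      ≡⟨ L-sub t (λ i → e I i - e S i) (λ i → e ⁅ x ⁆ i - e ⁅ y ⁆ i) ⟩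
    L t (λ i → e I i - e S i) - L t (λ i → e ⁅ x ⁆ i - e ⁅ y ⁆ i)
      ≡⟨ cong (_-_ (L t (λ i → e I i - e S i))) (trans (L-sub t (e ⁅ x ⁆) (e ⁅ y ⁆)) (cong₂ _-_ (L-e⁅⁆ t x) (L-e⁅⁆ t y))) ⟩
    L t (λ i → e I i - e S i) - (+ dist x t - + dist y t)
      ∎
    where
    open ≡-Reasoning
    regroup : ∀ u s y x → u - ((s - y) + x) ≡ (u - s) - (x - y)
    regroup = solve-∀

  minL : ∀ {n} → Subset n → Subset n → ℤ
  minL K I = minFin (λ t → L t (λ i → e I i - e K i))
open LinearForms

module Exchange where
  open import Data.Integer using (ℤ; 0ℤ; _+_; _-_; -_; _≤_; nonNegative)
  import Data.Integer.Properties as ℤₚ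
  open import Data.Integer.Tactic.RingSolver using (solve-∀)

  exchange : ∀ {n} (p α γ : Fin n → ℤ) → ℤ
  exchange p α γ =
    (minFin p + minFin (λ t → (p t - α t) - γ t)) - (minFin (λ t → p t - α t) + minFin (λ t → p t - γ t))

  minFin-shift : ∀ {n} {f g : Fin (suc n) → ℤ} c → (∀ t → g t ≡ f t + c) → minFin g ≡ minFin f + c
  minFin-shift {f = f} c g≗f+c = trans (minFin-cong g≗f+c) (minFin-+ f c)

  module _ {m : ℕ} (p α γ : Fin (suc m) → ℤ) where

    exchange-shift : ∀ α₀ γ₀ → exchange p (λ t → α₀ + α t) (λ t → γ₀ + γ t) ≡ exchange p α γ
    exchange-shift α₀ γ₀ =
      trans (cong₂ _-_ (cong (_+_ (minFin p)) (minFin-shift (- (α₀ + γ₀)) (λ t → shift₂ (p t) (α t) (γ t) α₀ γ₀)))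
                       (cong₂ _+_ (minFin-shift (- α₀) (λ t → shift₁ (p t) (α t) α₀))
                                  (minFin-shift (- γ₀) (λ t → shift₁ (p t) (γ t) γ₀))))
            (cancel (minFin p) (minFin (λ t → (p t - α t) - γ t)) (minFin (λ t → p t - α t))
                    (minFin (λ t → p t - γ t)) α₀ γ₀)
      where
      shift₁ : ∀ x y c → x - (c + y) ≡ (x - y) + - c
      shift₁ = solve-∀
      shift₂ : ∀ x y z c c′ → (x - (c + y)) - (c′ + z) ≡ ((x - y) - z) + - (c + c′)
      shift₂ = solve-∀
      cancel : ∀ P X Y Z c c′ → (P + (X + - (c + c′))) - ((Y + - c) + (Z + - c′)) ≡ (P + X) - (Y + Z)
      cancel = solve-∀

    exchange-comm : exchange p α γ ≡ exchange p γ α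
    exchange-comm = cong₂ _-_ (cong (_+_ (minFin p)) (minFin-cong (λ t → swap (p t) (α t) (γ t))))
                              (ℤₚ.+-comm (minFin (λ t → p t - α t)) (minFin (λ t → p t - γ t)))
      where
      swap : ∀ x y z → (x - y) - z ≡ (x - z) - y
      swap = solve-∀

    -- Bound min (p - α) by its value at a minimiser s of p, and min (p - γ) by its value at t.
    exchange-nonneg-at : (∀ t → 0ℤ ≤ α t) → ∀ t → minFin (λ t → (p t - α t) - γ t) ≡ (p t - α t) - γ t →
                         α t ≡ 0ℤ → 0ℤ ≤ exchange p α γ
    exchange-nonneg-at α≥0 t min≡ αt≡0 with minFin-attained p
    ... | s , minp≡ = ℤₚ.i≤j⇒0≤j-i (begin
      minFin (λ t → p t - α t) + minFin (λ t → p t - γ t)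
        ≤⟨ ℤₚ.+-mono-≤ (minFin-≤ (λ t → p t - α t) s) (minFin-≤ (λ t → p t - γ t) t) ⟩
      (p s - α s) + (p t - γ t)
        ≤⟨ ℤₚ.+-monoˡ-≤ (p t - γ t) (ℤₚ.i-j≤i (p s) (α s) {{nonNegative (α≥0 s)}}) ⟩
      p s + (p t - γ t)
        ≡⟨ cong₂ _+_ minp≡ (trans min≡ drop-α) ⟨
      minFin p + minFin (λ t → (p t - α t) - γ t) ∎)
      where
      open ℤₚ.≤-Reasoning
      drop-α : (p t - α t) - γ t ≡ p t - γ t
      drop-α = trans (cong (λ x → (p t - x) - γ t) αt≡0) (cong (_- γ t) (ℤₚ.+-identityʳ (p t)))

  exchange-cong : ∀ {n} (p : Fin n → ℤ) {α α′ γ γ′ : Fin n → ℤ} → (∀ t → α t ≡ α′ t) → (∀ t → γ t ≡ γ′ t) →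
                  exchange p α γ ≡ exchange p α′ γ′
  exchange-cong p α≗α′ γ≗γ′ =
    cong₂ _-_ (cong (_+_ (minFin p)) (minFin-cong (λ t → cong₂ (λ u v → (p t - u) - v) (α≗α′ t) (γ≗γ′ t))))
              (cong₂ _+_ (minFin-cong (λ t → cong (_-_ (p t)) (α≗α′ t))) (minFin-cong (λ t → cong (_-_ (p t)) (γ≗γ′ t))))

  exchange-nonneg : ∀ {m} (p α γ : Fin (suc m) → ℤ) → (∀ t → 0ℤ ≤ α t) → (∀ t → 0ℤ ≤ γ t) →
                    (∀ t → α t ≡ 0ℤ ⊎ γ t ≡ 0ℤ) → 0ℤ ≤ exchange p α γ
  exchange-nonneg p α γ α≥0 γ≥0 disjoint with minFin-attained (λ t → (p t - α t) - γ t)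
  ... | t , min≡ with disjoint t
  ...   | inj₁ αt≡0 = exchange-nonneg-at p α γ α≥0 t min≡ αt≡0
  ...   | inj₂ γt≡0 = subst (0ℤ ≤_) (exchange-comm p γ α) (exchange-nonneg-at p γ α γ≥0 t min≡′ γt≡0)
    where
    swap : ∀ x y z → (x - y) - z ≡ (x - z) - y
    swap = solve-∀
    min≡′ : minFin (λ t → (p t - γ t) - α t) ≡ (p t - γ t) - α t
    min≡′ = trans (minFin-cong (λ t → swap (p t) (γ t) (α t))) (trans min≡ (swap (p t) (α t) (γ t)))

  exchange-≥ : ∀ {m} (p α γ : Fin (suc m) → ℤ) {M : ℤ} {b d} → (∀ t → p t ≡ 0ℤ) →
               (∀ t → α t + γ t ≤ M) → M ≤ α b → M ≤ γ d → M ≤ exchange p α γ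
  exchange-≥ p α γ {M} {b} {d} p≗0 α+γ≤M M≤αb M≤γd with minFin-attained p
  ... | s , minp≡ = begin
    M                        ≡⟨ rearrange M ⟩
    (0ℤ + - M) - (- M + - M) ≤⟨ ℤₚ.+-mono-≤ (ℤₚ.+-monoʳ-≤ 0ℤ lower) (ℤₚ.neg-mono-≤ (ℤₚ.+-mono-≤ upper-α upper-γ)) ⟩
    (0ℤ + Mαγ) - (Mα + Mγ)   ≡⟨ cong (λ x → (x + Mαγ) - (Mα + Mγ)) (trans minp≡ (p≗0 s)) ⟨
    exchange p α γ           ∎
    where
    open ℤₚ.≤-Reasoning
    Mα Mγ Mαγ : ℤ
    Mα  = minFin (λ t → p t - α t)
    Mγ  = minFin (λ t → p t - γ t)
    Mαγ = minFin (λ t → (p t - α t) - γ t)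
    rearrange : ∀ x → x ≡ (0ℤ + - x) - (- x + - x)
    rearrange = solve-∀
    negate : ∀ x y → - (x + y) ≡ (0ℤ - x) - y
    negate = solve-∀
    lower : - M ≤ Mαγ
    lower = minFin-glb (λ t → (p t - α t) - γ t) (λ t → begin
      - M                 ≤⟨ ℤₚ.neg-mono-≤ (α+γ≤M t) ⟩
      - (α t + γ t)       ≡⟨ negate (α t) (γ t) ⟩
      (0ℤ - α t) - γ t    ≡⟨ cong (λ x → (x - α t) - γ t) (p≗0 t) ⟨
      (p t - α t) - γ t   ∎)
    upper-α : Mα ≤ - M
    upper-α = begin
      minFin (λ t → p t - α t) ≤⟨ minFin-≤ (λ t → p t - α t) b ⟩
      p b - α b                ≡⟨ cong (_- α b) (p≗0 b) ⟩
      0ℤ - α b                 ≤⟨ ℤₚ.+-monoʳ-≤ 0ℤ (ℤₚ.neg-mono-≤ M≤αb) ⟩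
      0ℤ - M                   ≡⟨ ℤₚ.+-identityˡ (- M) ⟩
      - M                      ∎
    upper-γ : Mγ ≤ - M
    upper-γ = begin
      minFin (λ t → p t - γ t) ≤⟨ minFin-≤ (λ t → p t - γ t) d ⟩
      p d - γ d                ≡⟨ cong (_- γ d) (p≗0 d) ⟩
      0ℤ - γ d                 ≤⟨ ℤₚ.+-monoʳ-≤ 0ℤ (ℤₚ.neg-mono-≤ M≤γd) ⟩
      0ℤ - M                   ≡⟨ ℤₚ.+-identityˡ (- M) ⟩
      - M                      ∎
open Exchange

module IntervalMinimum where
  open import Data.Integer using (ℤ; +_; 0ℤ; 1ℤ; _+_; _-_; _*_; _≤_)
  import Data.Integer.Properties as ℤₚ
  open import Data.Integer.Tactic.RingSolver using (solve-∀)
  open import Data.Nat using (_<_; _∸_) renaming (_+_ to _+ℕ_; _≤_ to _≤ℕ_)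
  open import Relation.Nullary.Reflects using (ofʸ; ofⁿ)

  𝟙-< : ∀ {a b} → a < b → 𝟙 (a <ᵇ b) ≡ 1ℤ
  𝟙-< {a} {b} a<b with a <ᵇ b | ℕₚ.<ᵇ-reflects-< a b
  ... | true  | _       = refl
  ... | false | ofⁿ a≮b = ⊥-elim (a≮b a<b)

  𝟙-≥ : ∀ {a b} → b ≤ℕ a → 𝟙 (a <ᵇ b) ≡ 0ℤ
  𝟙-≥ {a} {b} b≤a with a <ᵇ b | ℕₚ.<ᵇ-reflects-< a b
  ... | true  | ofʸ a<b = ⊥-elim (ℕₚ.<⇒≱ a<b b≤a)
  ... | false | _       = refl

  prefix-sum-nonneg : ∀ {n} (u : Fin n → ℕ) (y : Fin n → ℤ) k w → sumFinℤ y ≡ 0ℤ →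
    (∀ i → u i < k → 0ℤ ≤ y i) → (∀ i → k ≤ℕ u i → y i ≤ 0ℤ) →
    0ℤ ≤ sumFinℤ (λ i → 𝟙 (u i <ᵇ w) * y i)
  prefix-sum-nonneg u y k w Σy≡0 head≥0 tail≤0 with ℕₚ.≤-total w k
  ... | inj₁ w≤k = sumFinℤ-nonneg term≥0
    where
    term≥0 : ∀ i → 0ℤ ≤ 𝟙 (u i <ᵇ w) * y i
    term≥0 i with u i <ᵇ w | ℕₚ.<ᵇ-reflects-< (u i) w
    ... | true  | ofʸ u<w = subst (0ℤ ≤_) (sym (ℤₚ.*-identityˡ (y i))) (head≥0 i (ℕₚ.<-≤-trans u<w w≤k))
    ... | false | _       = ℤₚ.≤-refl
  ... | inj₂ k≤w = ℤₚ.i-j≤0⇒i≤j (begin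
      0ℤ - S                                     ≡⟨ cong (_- S) Σy≡0 ⟨
      sumFinℤ y - S                              ≡⟨ sumFinℤ-sub y (λ i → 𝟙 (u i <ᵇ w) * y i) ⟨
      sumFinℤ (λ i → y i - 𝟙 (u i <ᵇ w) * y i)   ≤⟨ sumFinℤ-nonpos rest≤0 ⟩
      0ℤ                                         ∎)
    where
    open ℤₚ.≤-Reasoning
    S : ℤ
    S = sumFinℤ (λ i → 𝟙 (u i <ᵇ w) * y i)
    rest≤0 : ∀ i → y i - 𝟙 (u i <ᵇ w) * y i ≤ 0ℤ
    rest≤0 i with u i <ᵇ w | ℕₚ.<ᵇ-reflects-< (u i) w
    ... | true  | _       = ℤₚ.≤-reflexive (trans (cong (y i -_) (ℤₚ.*-identityˡ (y i))) (ℤₚ.+-inverseʳ (y i)))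
    ... | false | ofⁿ u≮w = ℤₚ.≤-trans (ℤₚ.≤-reflexive (ℤₚ.+-identityʳ (y i)))
                                       (tail≤0 i (ℕₚ.≤-trans k≤w (ℕₚ.≮⇒≥ u≮w)))

  module _ {m : ℕ} (j : Fin (suc m)) where
    private
      N : ℕ
      N = suc m

      j≤+N : ∀ (i : Fin N) → toℕ j ≤ℕ toℕ i +ℕ N
      j≤+N i = ℕₚ.≤-trans (ℕₚ.<⇒≤ (Finₚ.toℕ<n j)) (ℕₚ.m≤n+m N (toℕ i))

    -- Both sides are 1 exactly when i lies on the cyclic arc [j, t).
    𝟙-dist<dist : ∀ (i t : Fin N) → 𝟙 (dist i j <ᵇ dist t j) ≡ (𝟙 (toℕ i <ᵇ toℕ t) - 𝟙 (toℕ i <ᵇ toℕ j)) + 𝟙 (toℕ t <ᵇ toℕ j)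
    𝟙-dist<dist i t
      with toℕ i <ᵇ toℕ t | ℕₚ.<ᵇ-reflects-< (toℕ i) (toℕ t)
         | toℕ i <ᵇ toℕ j | ℕₚ.<ᵇ-reflects-< (toℕ i) (toℕ j)
         | toℕ t <ᵇ toℕ j | ℕₚ.<ᵇ-reflects-< (toℕ t) (toℕ j)
    ... | true  | ofʸ i<t | true  | ofʸ i<j | true  | ofʸ t<j =
      𝟙-< (subst₂ _<_ (sym (dist-< i<j)) (sym (dist-< t<j))
                       (ℕₚ.∸-monoˡ-< (ℕₚ.+-monoˡ-< N i<t) (j≤+N i)))
    ... | true  | _       | true  | ofʸ i<j | false | ofⁿ t≮j =
      𝟙-≥ (subst₂ _≤ℕ_ (sym (dist-≥ (ℕₚ.≮⇒≥ t≮j))) (sym (dist-< i<j))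
                        (ℕₚ.∸-monoˡ-≤ (toℕ j) (ℕₚ.≤-trans (ℕₚ.<⇒≤ (Finₚ.toℕ<n t)) (ℕₚ.m≤n+m N (toℕ i)))))
    ... | true  | ofʸ i<t | false | ofⁿ i≮j | true  | ofʸ t<j =
      ⊥-elim (i≮j (ℕₚ.<-trans i<t t<j))
    ... | true  | ofʸ i<t | false | ofⁿ i≮j | false | ofⁿ t≮j =
      𝟙-< (subst₂ _<_ (sym (dist-≥ (ℕₚ.≮⇒≥ i≮j))) (sym (dist-≥ (ℕₚ.≮⇒≥ t≮j)))
                       (ℕₚ.∸-monoˡ-< i<t (ℕₚ.≮⇒≥ i≮j)))
    ... | false | ofⁿ i≮t | true  | ofʸ i<j | true  | ofʸ t<j =
      𝟙-≥ (subst₂ _≤ℕ_ (sym (dist-< t<j)) (sym (dist-< i<j))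
                        (ℕₚ.∸-monoˡ-≤ (toℕ j) (ℕₚ.+-monoˡ-≤ N (ℕₚ.≮⇒≥ i≮t))))
    ... | false | ofⁿ i≮t | true  | ofʸ i<j | false | ofⁿ t≮j =
      ⊥-elim (i≮t (ℕₚ.<-≤-trans i<j (ℕₚ.≮⇒≥ t≮j)))
    ... | false | _       | false | ofⁿ i≮j | true  | ofʸ t<j =
      𝟙-< (subst₂ _<_ (sym (dist-≥ (ℕₚ.≮⇒≥ i≮j))) (sym (dist-< t<j))
                       (ℕₚ.∸-monoˡ-< (ℕₚ.<-≤-trans (Finₚ.toℕ<n i) (ℕₚ.m≤n+m N (toℕ t))) (ℕₚ.≮⇒≥ i≮j)))
    ... | false | ofⁿ i≮t | false | ofⁿ i≮j | false | ofⁿ t≮j =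
      𝟙-≥ (subst₂ _≤ℕ_ (sym (dist-≥ (ℕₚ.≮⇒≥ t≮j))) (sym (dist-≥ (ℕₚ.≮⇒≥ i≮j)))
                        (ℕₚ.∸-monoˡ-≤ (toℕ j) (ℕₚ.≮⇒≥ i≮t)))

    dist-rebase : ∀ i t → + dist i t - + dist i j ≡ + N * 𝟙 (dist i j <ᵇ dist t j) - + dist t j
    dist-rebase i t = begin
      + dist i t - + dist i j
        ≡⟨ cong₂ _-_ (dist-ℤ i t) (dist-ℤ i j) ⟩
      ((+ toℕ i - + toℕ t) + + N * x) - ((+ toℕ i - + toℕ j) + + N * y)
        ≡⟨ regroup (+ toℕ i) (+ toℕ t) (+ toℕ j) (+ N) x y z ⟩
      + N * ((x - y) + z) - ((+ toℕ t - + toℕ j) + + N * z)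
        ≡⟨ cong₂ (λ g d → + N * g - d) (𝟙-dist<dist i t) (dist-ℤ t j) ⟨
      + N * 𝟙 (dist i j <ᵇ dist t j) - + dist t j
        ∎
      where
      open ≡-Reasoning
      x y z : ℤ
      x = 𝟙 (toℕ i <ᵇ toℕ t)
      y = 𝟙 (toℕ i <ᵇ toℕ j)
      z = 𝟙 (toℕ t <ᵇ toℕ j)
      regroup : ∀ I T J N x y z → ((I - T) + N * x) - ((I - J) + N * y) ≡ N * ((x - y) + z) - ((T - J) + N * z)
      regroup = solve-∀

    L-rebase : ∀ {y : Fin N → ℤ} → sumFinℤ y ≡ 0ℤ → ∀ t →
               L t y - L j y ≡ + N * sumFinℤ (λ i → 𝟙 (dist i j <ᵇ dist t j) * y i)
    L-rebase {y} Σy≡0 t = begin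
      L t y - L j y
        ≡⟨ sumFinℤ-sub (λ i → + dist i t * y i) (λ i → + dist i j * y i) ⟨
      sumFinℤ (λ i → + dist i t * y i - + dist i j * y i)
        ≡⟨ sumFinℤ-cong step ⟩
      sumFinℤ (λ i → + N * (g i * y i) - w * y i)
        ≡⟨ sumFinℤ-sub (λ i → + N * (g i * y i)) (λ i → w * y i) ⟩
      sumFinℤ (λ i → + N * (g i * y i)) - sumFinℤ (λ i → w * y i)
        ≡⟨ cong₂ _-_ (sumFinℤ-*ˡ (+ N) (λ i → g i * y i)) (sumFinℤ-*ˡ w y) ⟩
      + N * S - w * sumFinℤ y
        ≡⟨ cong (λ σ → + N * S - w * σ) Σy≡0 ⟩
      + N * S - w * 0ℤ
        ≡⟨ trans (cong (λ c → + N * S - c) (ℤₚ.*-zeroʳ w)) (ℤₚ.+-identityʳ (+ N * S)) ⟩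
      + N * S
        ∎
      where
      open ≡-Reasoning
      g : Fin N → ℤ
      g i = 𝟙 (dist i j <ᵇ dist t j)
      w S : ℤ
      w = + dist t j
      S = sumFinℤ (λ i → g i * y i)
      factor : ∀ a b c → a * c - b * c ≡ (a - b) * c
      factor = solve-∀
      expand : ∀ a b c d → (a * b - c) * d ≡ a * (b * d) - c * d
      expand = solve-∀
      step : ∀ i → + dist i t * y i - + dist i j * y i ≡ + N * (g i * y i) - w * y i
      step i = trans (factor (+ dist i t) (+ dist i j) (y i))
                     (trans (cong (_* y i) (dist-rebase i t)) (expand (+ N) (g i) w (y i)))

    L-minimal-at : ∀ k {y : Fin N → ℤ} → sumFinℤ y ≡ 0ℤ →
                   (∀ i → dist i j < k → 0ℤ ≤ y i) → (∀ i → k ≤ℕ dist i j → y i ≤ 0ℤ) →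
                   ∀ t → L j y ≤ L t y
    L-minimal-at k {y} Σy≡0 head≥0 tail≤0 t = ℤₚ.0≤i-j⇒j≤i (begin
      0ℤ                                                  ≡⟨ ℤₚ.*-zeroʳ (+ N) ⟨
      + N * 0ℤ                                            ≤⟨ ℤₚ.*-monoˡ-≤-nonNeg (+ N) prefix≥0 ⟩
      + N * sumFinℤ (λ i → 𝟙 (dist i j <ᵇ dist t j) * y i) ≡⟨ L-rebase {y} Σy≡0 t ⟨
      L t y - L j y                                       ∎)
      where
      open ℤₚ.≤-Reasoning
      prefix≥0 : 0ℤ ≤ sumFinℤ (λ i → 𝟙 (dist i j <ᵇ dist t j) * y i)
      prefix≥0 = prefix-sum-nonneg (λ i → dist i j) y k (dist t j) Σy≡0 head≥0 tail≤0

    minFin-L-interval : ∀ k (K : Subset N) → sumFinℤ (e (interval k N j)) ≡ sumFinℤ (e K) →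
      minFin (λ t → L t (λ i → e (interval k N j) i - e K i)) ≡ L j (λ i → e (interval k N j) i - e K i)
    minFin-L-interval k K ΣI≡ΣK =
      ℤₚ.≤-antisym (minFin-≤ (λ t → L t y) j) (minFin-glb (λ t → L t y) (L-minimal-at k Σy≡0 head≥0 tail≤0))
      where
      I : Subset N
      I = interval k N j
      y : Fin N → ℤ
      y i = e I i - e K i
      Σy≡0 : sumFinℤ y ≡ 0ℤ
      Σy≡0 = trans (sumFinℤ-sub (e I) (e K)) (trans (cong (_- sumFinℤ (e K)) ΣI≡ΣK) (ℤₚ.+-inverseʳ (sumFinℤ (e K))))
      e-I : ∀ i → e I i ≡ 𝟙 (dist i j <ᵇ k)
      e-I i = trans (e≡𝟙∘lookup I i) (cong 𝟙 (Vecₚ.lookup∘tabulate (λ i → dist i j <ᵇ k) i))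
      head≥0 : ∀ i → dist i j < k → 0ℤ ≤ y i
      head≥0 i i∈I = ℤₚ.i≤j⇒0≤j-i (subst (e K i ≤_) (sym (trans (e-I i) (𝟙-< i∈I))) (e≤1 K i))
      tail≤0 : ∀ i → k ≤ℕ dist i j → y i ≤ 0ℤ
      tail≤0 i i∉I = ℤₚ.i≤j⇒i-j≤0 (subst (_≤ e K i) (sym (trans (e-I i) (𝟙-≥ i∉I))) (0≤e K i))
open IntervalMinimum

module DoubleSwap {m : ℕ} (J : Subset (suc m)) {a b c d : Fin (suc m)} (cyclic : CyclicOrder a b c d)
                  (a∉J : a ∉ J) (c∉J : c ∉ J) (b∈J : b ∈ J) (d∈J : d ∈ J) where
  open import Data.Integer as ℤ using (ℤ; +_; 0ℤ; _+_; _-_; _*_; _≤_)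
  import Data.Integer.Properties as ℤₚ
  open import Data.Integer.Tactic.RingSolver using (solve-∀)

  private
    N : ℕ
    N = suc m

  J[a/b] J[c/d] J[ac/bd] : Subset N
  J[a/b]   = (J ─ ⁅ b ⁆) ∪ ⁅ a ⁆
  J[c/d]   = (J ─ ⁅ d ⁆) ∪ ⁅ c ⁆
  J[ac/bd] = (J ─ (⁅ b ⁆ ∪ ⁅ d ⁆)) ∪ (⁅ a ⁆ ∪ ⁅ c ⁆)

  swap-ab : Swap J b a J[a/b]
  swap-ab = swap-─∪ a∉J b∈J

  swap-cd : Swap J d c J[c/d]
  swap-cd = swap-─∪ c∉J d∈J

  swap-ab-cd : Swap J[a/b] d c J[ac/bd]
  e-swap swap-ab-cd i = begin
    e J[ac/bd] i
      ≡⟨ e-∪ (J ─ (⁅ b ⁆ ∪ ⁅ d ⁆)) (⁅ a ⁆ ∪ ⁅ c ⁆) i outside-J ⟩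
    e (J ─ (⁅ b ⁆ ∪ ⁅ d ⁆)) i + e (⁅ a ⁆ ∪ ⁅ c ⁆) i
      ≡⟨ cong₂ _+_ (trans (e-─ J (⁅ b ⁆ ∪ ⁅ d ⁆) i inside-J) (cong (_-_ (e J i)) (e-∪ ⁅ b ⁆ ⁅ d ⁆ i (distinct b≢d))))
                   (e-∪ ⁅ a ⁆ ⁅ c ⁆ i (distinct a≢c)) ⟩
    (e J i - (e ⁅ b ⁆ i + e ⁅ d ⁆ i)) + (e ⁅ a ⁆ i + e ⁅ c ⁆ i)
      ≡⟨ regroup (e J i) (e ⁅ a ⁆ i) (e ⁅ b ⁆ i) (e ⁅ c ⁆ i) (e ⁅ d ⁆ i) ⟩
    (((e J i - e ⁅ b ⁆ i) + e ⁅ a ⁆ i) - e ⁅ d ⁆ i) + e ⁅ c ⁆ i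
      ≡⟨ cong (λ x → (x - e ⁅ d ⁆ i) + e ⁅ c ⁆ i) (e-swap swap-ab i) ⟨
    (e J[a/b] i - e ⁅ d ⁆ i) + e ⁅ c ⁆ i
      ∎
    where
    open ≡-Reasoning
    a≢c : a ≢ c
    a≢c = proj₁ (cyclic-distinct cyclic)
    b≢d : b ≢ d
    b≢d = proj₂ (cyclic-distinct cyclic)
    ∈⁅⁆⇒≡ : ∀ {x i} → i ∈ ⁅ x ⁆ → i ≡ x
    ∈⁅⁆⇒≡ {x} = Subsetₚ.x∈⁅y⁆⇒x≡y x
    distinct : ∀ {x y} → x ≢ y → i ∈ ⁅ x ⁆ → i ∉ ⁅ y ⁆
    distinct x≢y i∈x i∈y = x≢y (trans (sym (∈⁅⁆⇒≡ i∈x)) (∈⁅⁆⇒≡ i∈y))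
    outside-J : i ∈ J ─ (⁅ b ⁆ ∪ ⁅ d ⁆) → i ∉ ⁅ a ⁆ ∪ ⁅ c ⁆
    outside-J i∈J- i∈ac with Subsetₚ.x∈p∪q⁻ ⁅ a ⁆ ⁅ c ⁆ i∈ac
    ... | inj₁ i∈a = a∉J (subst (_∈ J) (∈⁅⁆⇒≡ i∈a) (Subsetₚ.p─q⊆p J (⁅ b ⁆ ∪ ⁅ d ⁆) i∈J-))
    ... | inj₂ i∈c = c∉J (subst (_∈ J) (∈⁅⁆⇒≡ i∈c) (Subsetₚ.p─q⊆p J (⁅ b ⁆ ∪ ⁅ d ⁆) i∈J-))
    inside-J : i ∈ ⁅ b ⁆ ∪ ⁅ d ⁆ → i ∈ J
    inside-J i∈bd with Subsetₚ.x∈p∪q⁻ ⁅ b ⁆ ⁅ d ⁆ i∈bd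
    ... | inj₁ i∈b = subst (_∈ J) (sym (∈⁅⁆⇒≡ i∈b)) b∈J
    ... | inj₂ i∈d = subst (_∈ J) (sym (∈⁅⁆⇒≡ i∈d)) d∈J
    regroup : ∀ j a b c d → (j - (b + d)) + (a + c) ≡ (((j - b) + a) - d) + c
    regroup = solve-∀

  defect : Subset N → ℤ
  defect I = (minL J I + minL J[ac/bd] I) - (minL J[a/b] I + minL J[c/d] I)

  private
    p : Subset N → Fin N → ℤ
    p I t = L t (λ i → e I i - e J i)

    α γ : Fin N → ℤ
    α t = + dist a t - + dist b t
    γ t = + dist c t - + dist d t

    A C : Fin N → ℤ
    A t = + N * arc (toℕ a) (toℕ b) (toℕ t)
    C t = + N * arc (toℕ c) (toℕ d) (toℕ t)

  L-J[a/b] : ∀ I t → L t (λ i → e I i - e J[a/b] i) ≡ p I t - α t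
  L-J[a/b] = L-swap swap-ab

  L-J[c/d] : ∀ I t → L t (λ i → e I i - e J[c/d] i) ≡ p I t - γ t
  L-J[c/d] = L-swap swap-cd

  L-J[ac/bd] : ∀ I t → L t (λ i → e I i - e J[ac/bd] i) ≡ (p I t - α t) - γ t
  L-J[ac/bd] I t = trans (L-swap swap-ab-cd I t) (cong (_- γ t) (L-J[a/b] I t))

  defect≡exchange : ∀ I → defect I ≡ exchange (p I) A C
  defect≡exchange I = begin
    defect I
      ≡⟨ cong₂ _-_ (cong (_+_ (minL J I)) (minFin-cong (L-J[ac/bd] I)))
                   (cong₂ _+_ (minFin-cong (L-J[a/b] I)) (minFin-cong (L-J[c/d] I))) ⟩
    exchange (p I) α γ
      ≡⟨ exchange-cong (p I) (proj₂ (dist-difference a b)) (proj₂ (dist-difference c d)) ⟩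
    exchange (p I) (λ t → proj₁ (dist-difference a b) + A t) (λ t → proj₁ (dist-difference c d) + C t)
      ≡⟨ exchange-shift (p I) A C (proj₁ (dist-difference a b)) (proj₁ (dist-difference c d)) ⟩
    exchange (p I) A C
      ∎
    where open ≡-Reasoning

  private
    N*arc-0∨N : ∀ x y t → + N * arc x y t ≡ 0ℤ ⊎ + N * arc x y t ≡ + N
    N*arc-0∨N x y t with arc-0∨1 x y t
    ... | inj₁ arc≡0 = inj₁ (trans (cong (+ N *_) arc≡0) (ℤₚ.*-zeroʳ (+ N)))
    ... | inj₂ arc≡1 = inj₂ (trans (cong (+ N *_) arc≡1) (ℤₚ.*-identityʳ (+ N)))

    0∨N⇒≥0 : ∀ {z} → z ≡ 0ℤ ⊎ z ≡ + N → 0ℤ ≤ z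
    0∨N⇒≥0 (inj₁ refl) = ℤₚ.≤-refl
    0∨N⇒≥0 (inj₂ refl) = ℤ.+≤+ ℕ.z≤n

    0∨N⇒≤N : ∀ {z} → z ≡ 0ℤ ⊎ z ≡ + N → z ≤ + N
    0∨N⇒≤N (inj₁ refl) = ℤ.+≤+ ℕ.z≤n
    0∨N⇒≤N (inj₂ refl) = ℤₚ.≤-refl

    A-or-C-zero : ∀ t → A t ≡ 0ℤ ⊎ C t ≡ 0ℤ
    A-or-C-zero t with arc-0∨1 (toℕ a) (toℕ b) (toℕ t) | arc-0∨1 (toℕ c) (toℕ d) (toℕ t)
    ... | inj₁ arc≡0 | _          = inj₁ (trans (cong (+ N *_) arc≡0) (ℤₚ.*-zeroʳ (+ N)))
    ... | inj₂ _     | inj₁ arc≡0 = inj₂ (trans (cong (+ N *_) arc≡0) (ℤₚ.*-zeroʳ (+ N)))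
    ... | inj₂ t∈ab  | inj₂ t∈cd  = ⊥-elim (arcs-disjoint cyclic t t∈ab t∈cd)

  defect-nonneg : ∀ I → 0ℤ ≤ defect I
  defect-nonneg I = subst (0ℤ ≤_) (sym (defect≡exchange I))
    (exchange-nonneg (p I) A C (λ t → 0∨N⇒≥0 (N*arc-0∨N _ _ (toℕ t))) (λ t → 0∨N⇒≥0 (N*arc-0∨N _ _ (toℕ t))) A-or-C-zero)

  defect-self : + N ≤ defect J
  defect-self = subst (+ N ≤_) (sym (defect≡exchange J))
    (exchange-≥ (p J) A C {b = b} {d = d} (λ t → L-zero t (λ i → ℤₚ.+-inverseʳ (e J i))) A+C≤N
                (ℤₚ.≤-reflexive (sym (N*arc-end a∉J b∈J))) (ℤₚ.≤-reflexive (sym (N*arc-end c∉J d∈J))))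
    where
    N*arc-end : ∀ {x y} → x ∉ J → y ∈ J → + N * arc (toℕ x) (toℕ y) (toℕ y) ≡ + N
    N*arc-end x∉J y∈J = trans (cong (+ N *_) (arc-end (λ x≡y → x∉J (subst (_∈ J) (sym (Finₚ.toℕ-injective x≡y)) y∈J))))
                              (ℤₚ.*-identityʳ (+ N))
    A+C≤N : ∀ t → A t + C t ≤ + N
    A+C≤N t with A-or-C-zero t
    ... | inj₁ A≡0 = subst (_≤ + N) (sym (trans (cong (_+ C t) A≡0) (ℤₚ.+-identityˡ (C t)))) (0∨N⇒≤N (N*arc-0∨N _ _ (toℕ t)))
    ... | inj₂ C≡0 = subst (_≤ + N) (sym (trans (cong (_+_ (A t)) C≡0) (ℤₚ.+-identityʳ (A t)))) (0∨N⇒≤N (N*arc-0∨N _ _ (toℕ t)))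

  defect-frozen : ∀ {k} → ∣ J ∣ ≡ k → ∀ I → ∣ I ∣ ≡ k → Frozen k N I → defect I ≡ 0ℤ
  defect-frozen {k} |J|≡k I |I|≡k (j , refl) = begin
    defect I
      ≡⟨ cong₂ _-_ (cong₂ _+_ (at-j J refl) (at-j J[ac/bd] Σ-J[ac/bd])) (cong₂ _+_ (at-j J[a/b] Σ-J[a/b]) (at-j J[c/d] Σ-J[c/d])) ⟩
    (L j (λ i → e I i - e J i) + L j (λ i → e I i - e J[ac/bd] i)) - (L j (λ i → e I i - e J[a/b] i) + L j (λ i → e I i - e J[c/d] i))
      ≡⟨ cong₂ _-_ (cong (_+_ (p I j)) (L-J[ac/bd] I j)) (cong₂ _+_ (L-J[a/b] I j) (L-J[c/d] I j)) ⟩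
    (p I j + ((p I j - α j) - γ j)) - ((p I j - α j) + (p I j - γ j))
      ≡⟨ cancel (p I j) (α j) (γ j) ⟩
    0ℤ
      ∎
    where
    open ≡-Reasoning
    cancel : ∀ x y z → (x + ((x - y) - z)) - ((x - y) + (x - z)) ≡ 0ℤ
    cancel = solve-∀
    ΣI≡ΣJ : sumFinℤ (e I) ≡ sumFinℤ (e J)
    ΣI≡ΣJ = trans (sumFinℤ-e I) (trans (cong +_ (trans |I|≡k (sym |J|≡k))) (sym (sumFinℤ-e J)))
    at-j : ∀ K → sumFinℤ (e K) ≡ sumFinℤ (e J) → minL K I ≡ L j (λ i → e I i - e K i)
    at-j K ΣK≡ΣJ = minFin-L-interval j k K (trans ΣI≡ΣJ (sym ΣK≡ΣJ))
    Σ-J[a/b] : sumFinℤ (e J[a/b]) ≡ sumFinℤ (e J)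
    Σ-J[a/b] = sumFinℤ-swap swap-ab
    Σ-J[c/d] : sumFinℤ (e J[c/d]) ≡ sumFinℤ (e J)
    Σ-J[c/d] = sumFinℤ-swap swap-cd
    Σ-J[ac/bd] : sumFinℤ (e J[ac/bd]) ≡ sumFinℤ (e J)
    Σ-J[ac/bd] = trans (sumFinℤ-swap swap-ab-cd) Σ-J[a/b]

open import Data.Rational using (ℚ; 0ℚ; _<_; _≤_; _+_; _-_; _*_; -_; _/_; toℚᵘ; Positive; NonNegative)
import Data.Rational.Properties as ℚₚ
import Data.Rational.Unnormalised as ℚᵘ
import Data.Rational.Unnormalised.Properties as ℚᵘₚ
open import Data.Rational.Solver using (module +-*-Solver)
open import Data.Integer as ℤ using (ℤ; +_)
import Data.Integer.Properties as ℤₚ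
open import Data.Integer.Tactic.RingSolver using (solve-∀)
open import Data.List using ([]; _∷_; map)
import Data.List.Properties as Listₚ
open import Data.List.Membership.Propositional using () renaming (_∈_ to _∈ˡ_)
import Data.List.Membership.Propositional.Properties as ∈ˡₚ
open import Data.List.Relation.Unary.Any using (here; there)
open import Relation.Nullary.Decidable using (T?)

fromℤ : ℤ → ℚ
fromℤ z = z / 1

fromℤ-+ : ∀ x y → fromℤ (x ℤ.+ y) ≡ fromℤ x + fromℤ y
fromℤ-+ x y = ℚₚ.toℚᵘ-injective (begin
  toℚᵘ (fromℤ (x ℤ.+ y))                ≈⟨ embed (x ℤ.+ y) ⟩
  ℚᵘ.mkℚᵘ (x ℤ.+ y) 0                   ≈⟨ ℚᵘ.*≡* (cross-multiply x y) ⟩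
  ℚᵘ.mkℚᵘ x 0 ℚᵘ.+ ℚᵘ.mkℚᵘ y 0          ≈⟨ ℚᵘₚ.+-cong (embed x) (embed y) ⟨
  toℚᵘ (fromℤ x) ℚᵘ.+ toℚᵘ (fromℤ y)    ≈⟨ ℚₚ.toℚᵘ-homo-+ (fromℤ x) (fromℤ y) ⟨
  toℚᵘ (fromℤ x + fromℤ y)              ∎)
  where
  open ℚᵘₚ.≃-Reasoning
  embed : ∀ z → toℚᵘ (fromℤ z) ℚᵘ.≃ ℚᵘ.mkℚᵘ z 0
  embed z = ℚₚ.toℚᵘ-fromℚᵘ (ℚᵘ.mkℚᵘ z 0)
  cross-multiply : ∀ x y → (x ℤ.+ y) ℤ.* + 1 ≡ ((x ℤ.* + 1) ℤ.+ (y ℤ.* + 1)) ℤ.* + 1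
  cross-multiply = solve-∀

fromℤ-neg : ∀ x → fromℤ (ℤ.- x) ≡ - fromℤ x
fromℤ-neg x = ℚₚ.toℚᵘ-injective (begin
  toℚᵘ (fromℤ (ℤ.- x))       ≈⟨ ℚₚ.toℚᵘ-fromℚᵘ (ℚᵘ.mkℚᵘ (ℤ.- x) 0) ⟩
  ℚᵘ.mkℚᵘ (ℤ.- x) 0          ≈⟨ ℚᵘₚ.-‿cong (ℚₚ.toℚᵘ-fromℚᵘ (ℚᵘ.mkℚᵘ x 0)) ⟨
  ℚᵘ.- toℚᵘ (fromℤ x)        ≈⟨ ℚₚ.toℚᵘ-homo‿- (fromℤ x) ⟨
  toℚᵘ (- fromℤ x)           ∎)
  where open ℚᵘₚ.≃-Reasoning

fromℤ-sub : ∀ x y → fromℤ (x ℤ.- y) ≡ fromℤ x - fromℤ y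
fromℤ-sub x y = trans (fromℤ-+ x (ℤ.- y)) (cong (_+_ (fromℤ x)) (fromℤ-neg y))

module _ {A : Set} where
  open +-*-Solver

  sumℚ-map-+ : ∀ (f g : A → ℚ) l → sumℚ (map (λ x → f x + g x) l) ≡ sumℚ (map f l) + sumℚ (map g l)
  sumℚ-map-+ f g []      = sym (ℚₚ.+-identityʳ 0ℚ)
  sumℚ-map-+ f g (x ∷ l) = trans (cong (_+_ (f x + g x)) (sumℚ-map-+ f g l))
                                 (interchange (f x) (g x) (sumℚ (map f l)) (sumℚ (map g l)))
    where
    interchange : ∀ a b c d → (a + b) + (c + d) ≡ (a + c) + (b + d)
    interchange = solve 4 (λ a b c d → (a :+ b) :+ (c :+ d) := (a :+ c) :+ (b :+ d)) refl

  sumℚ-map-sub : ∀ (f g : A → ℚ) l → sumℚ (map (λ x → f x - g x) l) ≡ sumℚ (map f l) - sumℚ (map g l)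
  sumℚ-map-sub f g []      = sym (ℚₚ.+-identityʳ 0ℚ)
  sumℚ-map-sub f g (x ∷ l) = trans (cong (_+_ (f x - g x)) (sumℚ-map-sub f g l))
                                 (interchange (f x) (g x) (sumℚ (map f l)) (sumℚ (map g l)))
    where
    interchange : ∀ a b c d → (a - b) + (c - d) ≡ (a + c) - (b + d)
    interchange = solve 4 (λ a b c d → (a :- b) :+ (c :- d) := (a :+ c) :- (b :+ d)) refl

  sumℚ-nonneg : ∀ (f : A → ℚ) l → (∀ x → x ∈ˡ l → 0ℚ ≤ f x) → 0ℚ ≤ sumℚ (map f l)
  sumℚ-nonneg f []      _   = ℚₚ.≤-refl
  sumℚ-nonneg f (x ∷ l) f≥0 = subst (_≤ sumℚ (map f (x ∷ l))) (ℚₚ.+-identityʳ 0ℚ)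
    (ℚₚ.+-mono-≤ (f≥0 x (here refl)) (sumℚ-nonneg f l (λ y y∈l → f≥0 y (there y∈l))))

  sumℚ-pos : ∀ (f : A → ℚ) l → (∀ x → x ∈ˡ l → 0ℚ ≤ f x) → ∀ {y} → y ∈ˡ l → 0ℚ < f y → 0ℚ < sumℚ (map f l)
  sumℚ-pos f (x ∷ l) f≥0 (here refl) fy>0 = subst (_< sumℚ (map f (x ∷ l))) (ℚₚ.+-identityʳ 0ℚ)
    (ℚₚ.+-mono-<-≤ fy>0 (sumℚ-nonneg f l (λ y y∈l → f≥0 y (there y∈l))))
  sumℚ-pos f (x ∷ l) f≥0 (there y∈l) fy>0 = subst (_< sumℚ (map f (x ∷ l))) (ℚₚ.+-identityʳ 0ℚ)
    (ℚₚ.+-mono-≤-< (f≥0 x (here refl)) (sumℚ-pos f l (λ y y∈l → f≥0 y (there y∈l)) y∈l fy>0))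

∈-allSubsets : ∀ {n} (S : Subset n) → S ∈ˡ allSubsets n
∈-allSubsets []          = here refl
∈-allSubsets (true ∷ S)  = ∈ˡₚ.∈-++⁺ˡ (∈ˡₚ.∈-map⁺ (true ∷_) (∈-allSubsets S))
∈-allSubsets {suc n} (false ∷ S) =
  ∈ˡₚ.∈-++⁺ʳ (map (true ∷_) (allSubsets n)) (∈ˡₚ.∈-map⁺ (false ∷_) (∈-allSubsets S))

∈-kSubsets⁺ : ∀ {k n} {S : Subset n} → ∣ S ∣ ≡ k → S ∈ˡ kSubsets k n
∈-kSubsets⁺ {k} {S = S} |S|≡k = ∈ˡₚ.∈-filter⁺ (T? ∘ λ I → ∣ I ∣ ≡ᵇ k) (∈-allSubsets S) (ℕₚ.≡⇒≡ᵇ ∣ S ∣ k |S|≡k)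

∈-kSubsets⁻ : ∀ {k n} {S : Subset n} → S ∈ˡ kSubsets k n → ∣ S ∣ ≡ k
∈-kSubsets⁻ {k} {n} {S} S∈ = ℕₚ.≡ᵇ⇒≡ ∣ S ∣ k (proj₂ (∈ˡₚ.∈-filter⁻ (T? ∘ λ I → ∣ I ∣ ≡ᵇ k) {xs = allSubsets n} S∈))

η-combination : ∀ k n (K₁ K₂ K₃ K₄ : Subset n) (s : Subset n → ℚ) →
  η k n K₁ s + η k n K₂ s - η k n K₃ s - η k n K₄ s
    ≡ invN n * sumℚ (map (λ I → fromℤ ((minL K₁ I ℤ.+ minL K₂ I) ℤ.- (minL K₃ I ℤ.+ minL K₄ I)) * (- s I)) (kSubsets k n))
η-combination k n K₁ K₂ K₃ K₄ s = begin
  η k n K₁ s + η k n K₂ s - η k n K₃ s - η k n K₄ s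
    ≡⟨ pull-out (invN n) (Σ K₁) (Σ K₂) (Σ K₃) (Σ K₄) ⟩
  invN n * (((Σ K₃ + Σ K₄) - Σ K₁) - Σ K₂)
    ≡⟨ cong (invN n *_) linear ⟨
  invN n * sumℚ (map (λ I → ((f K₃ I + f K₄ I) - f K₁ I) - f K₂ I) (kSubsets k n))
    ≡⟨ cong (λ σ → invN n * sumℚ σ) (Listₚ.map-cong term (kSubsets k n)) ⟩
  invN n * sumℚ (map (λ I → fromℤ ((minL K₁ I ℤ.+ minL K₂ I) ℤ.- (minL K₃ I ℤ.+ minL K₄ I)) * (- s I)) (kSubsets k n))
    ∎
  where
  open ≡-Reasoning
  open +-*-Solver
  f : Subset n → Subset n → ℚ
  f K I = fromℤ (minL K I) * s I
  Σ : Subset n → ℚ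
  Σ K = sumℚ (map (f K) (kSubsets k n))
  pull-out : ∀ r a b c d → ((- (r * a) + - (r * b)) - - (r * c)) - - (r * d) ≡ r * (((c + d) - a) - b)
  pull-out = solve 5 (λ r a b c d → ((:- (r :* a) :+ :- (r :* b)) :- :- (r :* c)) :- :- (r :* d)
                                     := r :* (((c :+ d) :- a) :- b)) refl
  linear : sumℚ (map (λ I → ((f K₃ I + f K₄ I) - f K₁ I) - f K₂ I) (kSubsets k n)) ≡ ((Σ K₃ + Σ K₄) - Σ K₁) - Σ K₂
  linear = trans (sumℚ-map-sub (λ I → (f K₃ I + f K₄ I) - f K₁ I) (f K₂) (kSubsets k n))
          (cong (_- Σ K₂) (trans (sumℚ-map-sub (λ I → f K₃ I + f K₄ I) (f K₁) (kSubsets k n))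
                                 (cong (_- Σ K₁) (sumℚ-map-+ (f K₃) (f K₄) (kSubsets k n)))))
  factor : ∀ a b c d x → ((c * x + d * x) - a * x) - b * x ≡ ((a + b) - (c + d)) * (- x)
  factor = solve 5 (λ a b c d x → ((c :* x :+ d :* x) :- a :* x) :- b :* x := ((a :+ b) :- (c :+ d)) :* (:- x)) refl
  term : ∀ I → ((f K₃ I + f K₄ I) - f K₁ I) - f K₂ I
             ≡ fromℤ ((minL K₁ I ℤ.+ minL K₂ I) ℤ.- (minL K₃ I ℤ.+ minL K₄ I)) * (- s I)
  term I = trans (factor (fromℤ (minL K₁ I)) (fromℤ (minL K₂ I)) (fromℤ (minL K₃ I)) (fromℤ (minL K₄ I)) (s I))
    (cong (_* (- s I)) (sym (trans (fromℤ-sub (minL K₁ I ℤ.+ minL K₂ I) (minL K₃ I ℤ.+ minL K₄ I))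
                                   (cong₂ _-_ (fromℤ-+ (minL K₁ I) (minL K₂ I)) (fromℤ-+ (minL K₃ I) (minL K₄ I))))))

*-nonneg : ∀ r .{{_ : NonNegative r}} {x} → 0ℚ ≤ x → 0ℚ ≤ r * x
*-nonneg r {x} 0≤x = subst (_≤ r * x) (ℚₚ.*-zeroʳ r) (ℚₚ.*-monoˡ-≤-nonNeg r 0≤x)

*-pos : ∀ r .{{_ : Positive r}} {x} → 0ℚ < x → 0ℚ < r * x
*-pos r {x} 0<x = subst (_< r * x) (ℚₚ.*-zeroʳ r) (ℚₚ.*-monoʳ-<-pos r 0<x)

fromℤ-*-nonneg : ∀ {w x} → ℤ.0ℤ ℤ.≤ w → 0ℚ ≤ x → 0ℚ ≤ fromℤ w * x
fromℤ-*-nonneg {+ n} _ = *-nonneg (fromℤ (+ n)) {{ℚₚ.normalize-nonNeg n 1}}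

fromℤ-*-pos : ∀ {w x} → ℤ.0ℤ ℤ.< w → 0ℚ < x → 0ℚ < fromℤ w * x
fromℤ-*-pos {+ zero}  (ℤ.+<+ ())
fromℤ-*-pos {+ suc n} _ = *-pos (fromℤ (+ suc n)) {{ℚₚ.normalize-pos (suc n) 1}}

mainTheorem7 : (k n : ℕ) → 2 ℕ.≤ k → k ℕ.+ 2 ℕ.≤ n →
    (s₀ : Subset n → ℚ) → InKD k n s₀ →
    (J : Subset n) → ∣ J ∣ ≡ k → ¬ Frozen k n J →
    (a b c d : Fin n) → CyclicOrder a b c d →
    a ∉ J → c ∉ J → b ∈ J → d ∈ J →
    let Δ = η k n J s₀ + η k n ((J ─ (⁅ b ⁆ ∪ ⁅ d ⁆)) ∪ (⁅ a ⁆ ∪ ⁅ c ⁆)) s₀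
            - η k n ((J ─ ⁅ b ⁆) ∪ ⁅ a ⁆) s₀ - η k n ((J ─ ⁅ d ⁆) ∪ ⁅ c ⁆) s₀
    in (0ℚ ≤ Δ) × (Interior k n s₀ → 0ℚ < Δ)
mainTheorem7 k zero _ k+2≤0 with () ← ℕₚ.m+n≤o⇒n≤o k k+2≤0
mainTheorem7 k (suc m) _ _ s₀ (_ , nonfrozen≤0 , _) J |J|≡k J-nonfrozen a b c d cyclic a∉J c∉J b∈J d∈J =
  subst (0ℚ ≤_) (sym Δ≡) (*-nonneg (invN (suc m)) {{ℚₚ.normalize-nonNeg 1 (suc m)}} Σ≥0) ,
  λ interior → subst (0ℚ <_) (sym Δ≡) (*-pos (invN (suc m)) {{ℚₚ.normalize-pos 1 (suc m)}} (Σ>0 interior))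
  where
  open DoubleSwap J cyclic a∉J c∉J b∈J d∈J
  term : Subset (suc m) → ℚ
  term I = fromℤ (defect I) * (- s₀ I)
  Σterms : ℚ
  Σterms = sumℚ (map term (kSubsets k (suc m)))
  Δ≡ : η k (suc m) J s₀ + η k (suc m) J[ac/bd] s₀ - η k (suc m) J[a/b] s₀ - η k (suc m) J[c/d] s₀
       ≡ invN (suc m) * Σterms
  Δ≡ = η-combination k (suc m) J J[ac/bd] J[a/b] J[c/d] s₀
  -- A nonzero defect rules out that I is frozen, so s₀ I ≤ 0 applies.
  term≥0 : ∀ I → I ∈ˡ kSubsets k (suc m) → 0ℚ ≤ term I
  term≥0 I I∈ with defect I ℤ.≟ ℤ.0ℤ
  ... | yes defect≡0 = subst (λ w → 0ℚ ≤ fromℤ w * (- s₀ I)) (sym defect≡0) (ℚₚ.≤-reflexive (sym (ℚₚ.*-zeroˡ (- s₀ I))))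
  ... | no  defect≢0 = fromℤ-*-nonneg (defect-nonneg I)
          (ℚₚ.neg-antimono-≤ (nonfrozen≤0 I |I|≡k (defect≢0 ∘ defect-frozen |J|≡k I |I|≡k)))
    where
    |I|≡k : ∣ I ∣ ≡ k
    |I|≡k = ∈-kSubsets⁻ I∈
  Σ≥0 : 0ℚ ≤ Σterms
  Σ≥0 = sumℚ-nonneg term (kSubsets k (suc m)) term≥0
  Σ>0 : Interior k (suc m) s₀ → 0ℚ < Σterms
  Σ>0 interior = sumℚ-pos term (kSubsets k (suc m)) term≥0 (∈-kSubsets⁺ |J|≡k)
    (fromℤ-*-pos (ℤₚ.<-≤-trans (ℤ.+<+ ℕ.z<s) defect-self) (ℚₚ.neg-antimono-< (interior J |J|≡k J-nonfrozen)))
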